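{- For all integers $f \ge 1$ and all $k \ge 1$, there is a family of $n$-node weighted graphs $G$ (with $n$ arbitrarily large) such that every $f$-EFT $k$-spanner $H$ of $G$ has competitive lightness $$\ell_{f}(H \mid G) \geq \Omega\left( \frac{n}{f^2 k}\right).$$
   Context: Graphs $G=(V,E,w)$ have nonnegative edge weights; $w(H)$ denotes the total edge weight of a subgraph $H$, and $\mathrm{dist}_H$ the weighted shortest-path distance in $H$. An edge-subgraph $H$ of $G$ is an $f$-edge fault tolerant ($f$-EFT) $k$-spanner of $G$ if $\mathrm{dist}_{H\setminus F}(u,v)\le k\cdot \mathrm{dist}_{G\setminus F}(u,v)$ for all $u,v\in V$ and all $F\subseteq E$ with $|F|\le f$. A subgraph $Q\subseteq G$ is an $f$-EFT connectivity preserver of $G$ if for every $F\subseteq E$ with $|F|\le f$, the connected components of $Q\setminus F$ equal those of $G\setminus F$. Letting $T_f(G)$ be the set of all $f$-EFT connectivity preservers of $G$, the $f$-competitive lightness of a subgraph $H$ of $G$ is $\ell_f(H\mid G) := w(H)/\min_{Q\in T_f(G)} w(Q)$.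
   Formalization: The parameter k ranges only over rationals k ≥ 1, and the edge weights of each graph G are taken in the rationals. -}

module Defs where

open import Data.Nat as ℕ using (ℕ; zero; suc)
open import Data.Fin using (Fin)
open import Data.Fin.Subset using (Subset; _∈_; _∉_; ⊤; _∩_; ∁; ∣_∣)
open import Data.Fin.Subset.Properties using (_∈?_)
open import Data.Product using (_×_; _,_; Σ; ∃; ∃-syntax)
open import Data.Sum using (_⊎_)
open import Data.Integer using (+_)
open import Data.Rational using (ℚ; 0ℚ; _+_; _*_; _≤_; _<_; _/_)
open import Relation.Binary.PropositionalEquality using (_≡_; _≢_)
open import Relation.Nullary using (¬_; yes; no)

record WGraph (n : ℕ) : Set where
  field
    m      : ℕ
    ends   : Fin m → Fin n × Fin n
    weight : Fin m → ℚ
    weight-nonneg : ∀ e → 0ℚ ≤ weight e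
    no-loops : ∀ e u v → ends e ≡ (u , v) → u ≢ v
    no-parallel : ∀ e e′ u v → ends e ≡ (u , v) →
                  (ends e′ ≡ (u , v) ⊎ ends e′ ≡ (v , u)) → e ≡ e′
open WGraph public

EdgeSet : ∀ {n} → WGraph n → Set
EdgeSet G = Subset (m G)

Joins : ∀ {n} (G : WGraph n) → Fin (m G) → Fin n → Fin n → Set
Joins G e u v = ends G e ≡ (u , v) ⊎ ends G e ≡ (v , u)

data Walk {n} (G : WGraph n) (S : EdgeSet G) : Fin n → Fin n → Set where
  [] : ∀ {u} → Walk G S u u
  _∷_ : ∀ {u v w} → (Σ (Fin (m G)) λ e → e ∈ S × Joins G e u v) →
        Walk G S v w → Walk G S u w

walkWeight : ∀ {n} {G : WGraph n} {S : EdgeSet G} {u v} → Walk G S u v → ℚ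
walkWeight [] = 0ℚ
walkWeight {G = G} ((e , _) ∷ p) = weight G e + walkWeight p

sumFin : ∀ k → (Fin k → ℚ) → ℚ
sumFin zero    g = 0ℚ
sumFin (suc k) g = g Fin.zero + sumFin k (λ i → g (Fin.suc i))
  where import Data.Fin as Fin

totalWeight : ∀ {n} (G : WGraph n) → EdgeSet G → ℚ
totalWeight G S = sumFin (m G) λ e → inW e (e ∈? S)
  where
    open import Relation.Nullary using (Dec)
    inW : ∀ e → Dec (e ∈ S) → ℚ
    inW e (yes _) = weight G e
    inW e (no _)  = 0ℚ

_∖_ : ∀ {k} → Subset k → Subset k → Subset k
S ∖ F = S ∩ ∁ F

Connected : ∀ {n} (G : WGraph n) → EdgeSet G → Fin n → Fin n → Set
Connected G S u v = Walk G S u v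

-- f-EFT k-spanner: for every fault set F (|F| ≤ f) and u, v,
-- dist_{H∖F}(u,v) ≤ k · dist_{G∖F}(u,v), unfolded through the definition of
-- dist as a minimum over walks (∞ if none): every u–v walk P in G∖F is matched
-- by a u–v walk Q in H∖F with w(Q) ≤ k·w(P).
IsFTSpanner : ∀ {n} (G : WGraph n) (f : ℕ) (k : ℚ) → EdgeSet G → Set
IsFTSpanner G f k H =
  ∀ (F : EdgeSet G) → ∣ F ∣ ℕ.≤ f → ∀ u v → (P : Walk G (⊤ ∖ F) u v) →
  ∃[ Q ] (walkWeight {G = G} {S = H ∖ F} {u} {v} Q ≤ k * walkWeight P)

IsFTConnPreserver : ∀ {n} (G : WGraph n) (f : ℕ) → EdgeSet G → Set
IsFTConnPreserver G f Q =
  ∀ (F : EdgeSet G) → ∣ F ∣ ℕ.≤ f → ∀ u v →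
  (Connected G (Q ∖ F) u v → Connected G (⊤ ∖ F) u v) ×
  (Connected G (⊤ ∖ F) u v → Connected G (Q ∖ F) u v)

ℕ→ℚ : ℕ → ℚ
ℕ→ℚ a = (+ a) / 1

{-# OPTIONS --safe #-}
-- The graph is a path of hubs 0, …, L+1 whose consecutive hubs are joined by f
-- internally disjoint two-edge paths of weight 0 (the rails), plus a chord of
-- weight 1 across every gap except the first and a long edge of weight 2k
-- between the two end hubs.
--
-- Faulting the f rails that leave the first gap makes the long edge a bridge, so
-- every f-EFT connectivity preserver contains it and weighs at least 2k.  The
-- rails together with the long edge are such a preserver: f faults that block
-- every rail of one gap spare all other edges, and the way round through the long
-- edge reconnects that gap.  Faulting the rails that leave gap i+1 leaves only
-- chord i (weight 1) and the long edge (weight 2k > k) across it, so every f-EFT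
-- k-spanner contains all L chords.  Hence w(H)/w(Q) ≥ L/(2k) while n ≤ 5 L f².
module Submission where

open import Defs
open import Data.Nat using (ℕ; _≥_)
open import Data.Product using (Σ; _×_; ∃-syntax)
open import Data.Rational using (ℚ; 0ℚ; 1ℚ; _*_; _≤_; _<_)

open import Data.Empty using (⊥-elim)
open import Data.Fin.Base using (Fin; zero; suc; toℕ; _↑ˡ_; inject₁; fromℕ)
import Data.Fin.Properties as Fin
open import Data.Fin.Induction using (<-weakInduction; >-weakInduction)
open import Data.Fin.Properties using (+↔⊎; *↔×; 1↔⊤)
open import Data.Fin.Subset using (Subset; _∈_; _∉_; _⊆_; ⊤; ⊥; ∁; _∪_; ⁅_⁆; _-_; ∣_∣; inside; outside)
open import Data.Fin.Subset.Properties
  using (_∈?_; ∈⊤; ∉⊥; x∈⁅x⁆; x∈⁅y⁆⇒x≡y; x∈p∪q⁺; x∈p∪q⁻; x∈p∩q⁺; x∈p∩q⁻;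
         x∉p⇒x∈∁p; x∈∁p⇒x∉p;
         ∣⊥∣≡0; ∣⁅x⁆∣≡1; ∣p∣≤∣x∷p∣; p─⊥≡p; x∈p∧x≢y⇒x∈p-y; x∈p⇒∣p-x∣<∣p∣)
import Data.Integer.Base as ℤ
import Data.Integer.Properties as ℤ
open import Data.Nat.Base as ℕ using (zero; suc; z≤n; s≤s)
import Data.Nat.Properties as ℕ
import Data.Nat.Coprimality as Coprime
open import Data.Product using (_,_; proj₁; proj₂; ∃₂)
import Data.Product as Product
open import Data.Rational.Base using (_+_; _/_; mkℚ; *≤*; nonNegative)
import Data.Rational.Properties as ℚ
open import Data.Sum.Base using (_⊎_; inj₁; inj₂)
open import Data.Sum.Function.Propositional using (_⊎-↔_)
open import Data.Unit.Base using (tt) renaming (⊤ to Unit)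
open import Data.Vec.Base using ([]; _∷_)
open import Function.Base using (_∘_)
open import Function.Bundles using (_↔_; Inverse; Injection; mk↔ₛ′)
open import Function.Definitions using (Injective)
open import Function.Properties.Inverse using (↔-sym; ↔-trans; ↔-refl; ↔⇒↣)
open import Relation.Binary.PropositionalEquality
open import Relation.Nullary using (¬_; ¬?; yes; no)
open import Relation.Nullary.Decidable using (_×-dec_; decidable-stable)
open import Relation.Unary using (Pred; Decidable)

p≤p+q : ∀ {p q} → 0ℚ ≤ q → p ≤ p + q
p≤p+q {p} {q} 0≤q = subst (_≤ p + q) (ℚ.+-identityʳ p) (ℚ.+-monoʳ-≤ p 0≤q)

p≤q+p : ∀ {p q} → 0ℚ ≤ q → p ≤ q + p
p≤q+p {p} {q} 0≤q = subst (_≤ q + p) (ℚ.+-identityˡ p) (ℚ.+-monoˡ-≤ p 0≤q)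

ℕ→ℚ≡mkℚ : ∀ a → ℕ→ℚ a ≡ mkℚ (ℤ.+ a) 0 (Coprime.sym (Coprime.1-coprimeTo a))
ℕ→ℚ≡mkℚ a = ℚ.normalize-coprime (Coprime.sym (Coprime.1-coprimeTo a))

ℕ→ℚ-suc : ∀ a → ℕ→ℚ (suc a) ≡ 1ℚ + ℕ→ℚ a
ℕ→ℚ-suc a = begin
  (ℤ.+ suc a) / 1                        ≡⟨ cong (λ z → ((ℤ.+ 1) ℤ.+ z) / 1) (ℤ.*-identityʳ (ℤ.+ a)) ⟨
  ((ℤ.+ 1) ℤ.+ (ℤ.+ a) ℤ.* (ℤ.+ 1)) / 1  ≡⟨ cong (1ℚ +_) (ℕ→ℚ≡mkℚ a) ⟨
  1ℚ + ℕ→ℚ a                             ∎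
  where open ≡-Reasoning

ℕ→ℚ-* : ∀ a b → ℕ→ℚ (a ℕ.* b) ≡ ℕ→ℚ a * ℕ→ℚ b
ℕ→ℚ-* a b = trans (cong (_/ 1) (ℤ.pos-* a b)) (sym (cong₂ _*_ (ℕ→ℚ≡mkℚ a) (ℕ→ℚ≡mkℚ b)))

ℕ→ℚ-mono-≤ : ∀ {a b} → a ℕ.≤ b → ℕ→ℚ a ≤ ℕ→ℚ b
ℕ→ℚ-mono-≤ {a} {b} a≤b = subst₂ _≤_ (sym (ℕ→ℚ≡mkℚ a)) (sym (ℕ→ℚ≡mkℚ b))
  (*≤* (subst₂ ℤ._≤_ (sym (ℤ.*-identityʳ (ℤ.+ a))) (sym (ℤ.*-identityʳ (ℤ.+ b))) (ℤ.+≤+ a≤b)))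

sumFin-nonNeg : ∀ k {g : Fin k → ℚ} → (∀ i → 0ℚ ≤ g i) → 0ℚ ≤ sumFin k g
sumFin-nonNeg zero    _   = ℚ.≤-refl
sumFin-nonNeg (suc k) g≥0 = ℚ.≤-trans (g≥0 zero) (p≤p+q (sumFin-nonNeg k (g≥0 ∘ suc)))

term≤sumFin : ∀ k {g : Fin k → ℚ} → (∀ i → 0ℚ ≤ g i) → ∀ i → g i ≤ sumFin k g
term≤sumFin (suc k) g≥0 zero    = p≤p+q (sumFin-nonNeg k (g≥0 ∘ suc))
term≤sumFin (suc k) g≥0 (suc i) = ℚ.≤-trans (term≤sumFin k (g≥0 ∘ suc) i) (p≤q+p (g≥0 zero))

sumFin-zero : ∀ k {g : Fin k → ℚ} → (∀ i → g i ≡ 0ℚ) → sumFin k g ≡ 0ℚ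
sumFin-zero zero    _   = refl
sumFin-zero (suc k) g≡0 = cong₂ _+_ (g≡0 zero) (sumFin-zero k (g≡0 ∘ suc))

sumFin-single : ∀ k {g : Fin k → ℚ} i → (∀ j → j ≢ i → g j ≡ 0ℚ) → sumFin k g ≡ g i
sumFin-single (suc k) {g} zero    g≡0 =
  trans (cong (g zero +_) (sumFin-zero k (λ j → g≡0 (suc j) λ ()))) (ℚ.+-identityʳ (g zero))
sumFin-single (suc k) {g} (suc i) g≡0 =
  trans (cong₂ _+_ (g≡0 zero λ ()) (sumFin-single k i (λ j j≢i → g≡0 (suc j) (j≢i ∘ Fin.suc-injective))))
        (ℚ.+-identityˡ (g (suc i)))

sumFin-↑ˡ : ∀ a b {g : Fin (a ℕ.+ b) → ℚ} → (∀ i → 0ℚ ≤ g i) →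
            sumFin a (g ∘ (_↑ˡ b)) ≤ sumFin (a ℕ.+ b) g
sumFin-↑ˡ zero    b     g≥0 = sumFin-nonNeg b g≥0
sumFin-↑ˡ (suc a) b {g} g≥0 = ℚ.+-monoʳ-≤ (g zero) (sumFin-↑ˡ a b (g≥0 ∘ suc))

sumFin-ones : ∀ k {g : Fin k → ℚ} → (∀ i → g i ≡ 1ℚ) → sumFin k g ≡ ℕ→ℚ k
sumFin-ones zero    _   = refl
sumFin-ones (suc k) g≡1 = trans (cong₂ _+_ (g≡1 zero) (sumFin-ones k (g≡1 ∘ suc))) (sym (ℕ→ℚ-suc k))

module _ {n} (G : WGraph n) where

  -- The summand of totalWeight is local to Defs; unification recovers it.
  private
    summand-of : ∀ S → Σ (Fin (m G) → ℚ) λ g → totalWeight G S ≡ sumFin (m G) g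
    summand-of S = _ , refl

  summand : EdgeSet G → Fin (m G) → ℚ
  summand S = proj₁ (summand-of S)

  summand-nonNeg : ∀ S e → 0ℚ ≤ summand S e
  summand-nonNeg S e with e ∈? S
  ... | yes _ = weight-nonneg G e
  ... | no  _ = ℚ.≤-refl

  summand-∈ : ∀ {S e} → e ∈ S → summand S e ≡ weight G e
  summand-∈ {S} {e} e∈S with e ∈? S
  ... | yes _   = refl
  ... | no  e∉S = ⊥-elim (e∉S e∈S)

  weight≤totalWeight : ∀ {S e} → e ∈ S → weight G e ≤ totalWeight G S
  weight≤totalWeight {S} {e} e∈S =
    subst (_≤ totalWeight G S) (summand-∈ e∈S) (term≤sumFin (m G) (summand-nonNeg S) e)

  totalWeight-single : ∀ {S e} → e ∈ S → (∀ e′ → e′ ∈ S → e′ ≢ e → weight G e′ ≡ 0ℚ) →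
                       totalWeight G S ≡ weight G e
  totalWeight-single {S} {e} e∈S others≡0 = trans (sumFin-single (m G) e vanishes) (summand-∈ e∈S)
    where
    vanishes : ∀ e′ → e′ ≢ e → summand S e′ ≡ 0ℚ
    vanishes e′ e′≢e with e′ ∈? S
    ... | yes e′∈S = others≡0 e′ e′∈S e′≢e
    ... | no  _    = refl

∈-∖⁺ : ∀ {k} {S F : Subset k} {x} → x ∈ S → x ∉ F → x ∈ S ∖ F
∈-∖⁺ x∈S x∉F = x∈p∩q⁺ (x∈S , x∉p⇒x∈∁p x∉F)

∈-∖⁻ : ∀ {k} {S F : Subset k} {x} → x ∈ S ∖ F → x ∈ S × x ∉ F
∈-∖⁻ {S = S} {F} x∈S∖F = Product.map₂ x∈∁p⇒x∉p (x∈p∩q⁻ S (∁ F) x∈S∖F)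

∣p∪q∣≤∣p∣+∣q∣ : ∀ {k} (p q : Subset k) → ∣ p ∪ q ∣ ℕ.≤ ∣ p ∣ ℕ.+ ∣ q ∣
∣p∪q∣≤∣p∣+∣q∣ []            []            = z≤n
∣p∪q∣≤∣p∣+∣q∣ (inside  ∷ p) (t ∷ q)       =
  s≤s (ℕ.≤-trans (∣p∪q∣≤∣p∣+∣q∣ p q) (ℕ.+-monoʳ-≤ ∣ p ∣ (∣p∣≤∣x∷p∣ t q)))
∣p∪q∣≤∣p∣+∣q∣ (outside ∷ p) (inside  ∷ q) =
  ℕ.≤-trans (s≤s (∣p∪q∣≤∣p∣+∣q∣ p q)) (ℕ.≤-reflexive (sym (ℕ.+-suc ∣ p ∣ ∣ q ∣)))
∣p∪q∣≤∣p∣+∣q∣ (outside ∷ p) (outside ∷ q) = ∣p∪q∣≤∣p∣+∣q∣ p q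

image : ∀ {j k} → (Fin j → Fin k) → Subset k
image {zero}  h = ⊥
image {suc j} h = ⁅ h zero ⁆ ∪ image (h ∘ suc)

∈-image⁺ : ∀ {j k} (h : Fin j → Fin k) r → h r ∈ image h
∈-image⁺ h zero    = x∈p∪q⁺ (inj₁ (x∈⁅x⁆ (h zero)))
∈-image⁺ h (suc r) = x∈p∪q⁺ (inj₂ (∈-image⁺ (h ∘ suc) r))

∈-image⁻ : ∀ {j k} (h : Fin j → Fin k) {x} → x ∈ image h → ∃[ r ] h r ≡ x
∈-image⁻ {zero}  h x∈⊥ = ⊥-elim (∉⊥ x∈⊥)
∈-image⁻ {suc j} h x∈ with x∈p∪q⁻ ⁅ h zero ⁆ (image (h ∘ suc)) x∈
... | inj₁ x∈⁅h₀⁆ = zero , sym (x∈⁅y⁆⇒x≡y (h zero) x∈⁅h₀⁆)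
... | inj₂ x∈rest = let r , hr≡x = ∈-image⁻ (h ∘ suc) x∈rest in suc r , hr≡x

∣image∣≤ : ∀ {j k} (h : Fin j → Fin k) → ∣ image h ∣ ℕ.≤ j
∣image∣≤ {zero}  {k} h = ℕ.≤-reflexive (∣⊥∣≡0 k)
∣image∣≤ {suc j}     h = begin
  ∣ ⁅ h zero ⁆ ∪ image (h ∘ suc) ∣        ≤⟨ ∣p∪q∣≤∣p∣+∣q∣ ⁅ h zero ⁆ (image (h ∘ suc)) ⟩
  ∣ ⁅ h zero ⁆ ∣ ℕ.+ ∣ image (h ∘ suc) ∣  ≡⟨ cong (ℕ._+ ∣ image (h ∘ suc) ∣) (∣⁅x⁆∣≡1 (h zero)) ⟩
  suc ∣ image (h ∘ suc) ∣                 ≤⟨ s≤s (∣image∣≤ (h ∘ suc)) ⟩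
  suc j                                   ∎
  where open ℕ.≤-Reasoning

injective⇒≤∣p∣ : ∀ {j k} {p : Subset k} (h : Fin j → Fin k) → Injective _≡_ _≡_ h →
                 (∀ r → h r ∈ p) → j ℕ.≤ ∣ p ∣
injective⇒≤∣p∣ {zero}          h _   _   = z≤n
injective⇒≤∣p∣ {suc j} {p = p} h inj h∈p = ℕ.≤-trans (s≤s rest≤) (x∈p⇒∣p-x∣<∣p∣ (h∈p zero))
  where
  rest≤ : j ℕ.≤ ∣ p - h zero ∣
  rest≤ = injective⇒≤∣p∣ (h ∘ suc) (Fin.suc-injective ∘ inj)
            (λ r → x∈p∧x≢y⇒x∈p-y (h∈p (suc r)) (Fin.0≢1+n ∘ sym ∘ inj))

module _ {n} {G : WGraph n} where

  infixr 5 _++ʷ_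

  _++ʷ_ : ∀ {S u v w} → Walk G S u v → Walk G S v w → Walk G S u w
  []      ++ʷ q = q
  (x ∷ p) ++ʷ q = x ∷ (p ++ʷ q)

  reverseʷ : ∀ {S u v} → Walk G S u v → Walk G S v u
  reverseʷ []                            = []
  reverseʷ ((e , e∈S , inj₁ eq) ∷ p) = reverseʷ p ++ʷ ((e , e∈S , inj₂ eq) ∷ [])
  reverseʷ ((e , e∈S , inj₂ eq) ∷ p) = reverseʷ p ++ʷ ((e , e∈S , inj₁ eq) ∷ [])

  Walk-mono : ∀ {S T u v} → S ⊆ T → Walk G S u v → Walk G T u v
  Walk-mono S⊆T []                    = []
  Walk-mono S⊆T ((e , e∈S , joins) ∷ p) = (e , S⊆T e∈S , joins) ∷ Walk-mono S⊆T p

  reroute : ∀ {S T u v} → (∀ {e} → e ∈ S → Walk G T (proj₁ (ends G e)) (proj₂ (ends G e))) →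
            Walk G S u v → Walk G T u v
  reroute bypass []                     = []
  reroute bypass ((e , e∈S , joins) ∷ p) = oriented joins (bypass e∈S) ++ʷ reroute bypass p
    where
    oriented : ∀ {T u v} → Joins G e u v → Walk G T (proj₁ (ends G e)) (proj₂ (ends G e)) → Walk G T u v
    oriented (inj₁ refl) q = q
    oriented (inj₂ refl) q = reverseʷ q

  walkWeight-nonNeg : ∀ {S u v} (p : Walk G S u v) → 0ℚ ≤ walkWeight p
  walkWeight-nonNeg []            = ℚ.≤-refl
  walkWeight-nonNeg ((e , _) ∷ p) = ℚ.≤-trans (weight-nonneg G e) (p≤p+q (walkWeight-nonNeg p))

  Crosses : ∀ {ℓ} → Pred (Fin n) ℓ → Fin (m G) → Set ℓ
  Crosses X e = ∃₂ λ x y → Joins G e x y × X x × ¬ X y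

  crossing-edge : ∀ {ℓ} {X : Pred (Fin n) ℓ} → Decidable X → ∀ {S u v} (p : Walk G S u v) → X u → ¬ X v →
                  ∃[ e ] (e ∈ S × Crosses X e × weight G e ≤ walkWeight p)
  crossing-edge X? []  Xu ¬Xv = ⊥-elim (¬Xv Xu)
  crossing-edge X? (_∷_ {v = w} (e , e∈S , joins) p) Xu ¬Xv with X? w
  ... | no ¬Xw = e , e∈S , (_ , _ , joins , Xu , ¬Xw) , p≤p+q (walkWeight-nonNeg p)
  ... | yes Xw =
    let e′ , e′∈S , crosses , w≤ = crossing-edge X? p Xw ¬Xv
    in  e′ , e′∈S , crosses , ℚ.≤-trans w≤ (p≤q+p (weight-nonneg G e))

-- A rank that strictly increases along every edge rules out loops and
-- antiparallel pairs, so injectivity of (tail, head) makes the graph simple.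
module RankedGraph {V E : Set} {n k : ℕ} (vertex↔ : V ↔ Fin n) (edge↔ : E ↔ Fin k)
                   (tail head : E → V) (w : E → ℚ) (w≥0 : ∀ x → 0ℚ ≤ w x)
                   (rank : V → ℕ) (rank-< : ∀ x → rank (tail x) ℕ.< rank (head x))
                   (endpoints-injective : ∀ {x y} → tail x ≡ tail y → head x ≡ head y → x ≡ y) where

  ⟦_⟧ : V → Fin n
  ⟦_⟧ = Inverse.to vertex↔

  vertexAt : Fin n → V
  vertexAt = Inverse.from vertex↔

  ⌊_⌋ : E → Fin k
  ⌊_⌋ = Inverse.to edge↔

  edgeAt : Fin k → E
  edgeAt = Inverse.from edge↔

  vertexAt-⟦⟧ : ∀ v → vertexAt ⟦ v ⟧ ≡ v
  vertexAt-⟦⟧ = Inverse.strictlyInverseʳ vertex↔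

  edgeAt-⌊⌋ : ∀ x → edgeAt ⌊ x ⌋ ≡ x
  edgeAt-⌊⌋ = Inverse.strictlyInverseʳ edge↔

  ⌊⌋-edgeAt : ∀ e → ⌊ edgeAt e ⌋ ≡ e
  ⌊⌋-edgeAt = Inverse.strictlyInverseˡ edge↔

  ⌊⌋-injective : ∀ {x y} → ⌊ x ⌋ ≡ ⌊ y ⌋ → x ≡ y
  ⌊⌋-injective = Injection.injective (↔⇒↣ edge↔)

  private
    ⟦⟧-injective : ∀ {u v} → ⟦ u ⟧ ≡ ⟦ v ⟧ → u ≡ v
    ⟦⟧-injective = Injection.injective (↔⇒↣ vertex↔)

    edgeAt-injective : ∀ {e e′} → edgeAt e ≡ edgeAt e′ → e ≡ e′
    edgeAt-injective = Injection.injective (↔⇒↣ (↔-sym edge↔))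

    no-loops′ : ∀ e u v → (⟦ tail (edgeAt e) ⟧ , ⟦ head (edgeAt e) ⟧) ≡ (u , v) → u ≢ v
    no-loops′ e u v refl u≡v = ℕ.<-irrefl (cong rank (⟦⟧-injective u≡v)) (rank-< (edgeAt e))

    no-parallel′ : ∀ e e′ u v → (⟦ tail (edgeAt e) ⟧ , ⟦ head (edgeAt e) ⟧) ≡ (u , v) →
                   (⟦ tail (edgeAt e′) ⟧ , ⟦ head (edgeAt e′) ⟧) ≡ (u , v) ⊎
                   (⟦ tail (edgeAt e′) ⟧ , ⟦ head (edgeAt e′) ⟧) ≡ (v , u) → e ≡ e′
    no-parallel′ e e′ _ _ refl (inj₁ eq) =
      edgeAt-injective (endpoints-injective (⟦⟧-injective (cong proj₁ (sym eq))) (⟦⟧-injective (cong proj₂ (sym eq))))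
    no-parallel′ e e′ _ _ refl (inj₂ eq) = ⊥-elim (ℕ.<-irrefl refl (begin-strict
      rank (tail x)   <⟨ rank-< x ⟩
      rank (head x)   ≡⟨ cong rank (⟦⟧-injective (cong proj₁ (sym eq))) ⟩
      rank (tail x′)  <⟨ rank-< x′ ⟩
      rank (head x′)  ≡⟨ cong rank (⟦⟧-injective (cong proj₂ eq)) ⟩
      rank (tail x)   ∎))
      where
      open ℕ.≤-Reasoning
      x x′ : E
      x  = edgeAt e
      x′ = edgeAt e′

  graph : WGraph n
  graph = record
    { m             = k
    ; ends          = λ e → ⟦ tail (edgeAt e) ⟧ , ⟦ head (edgeAt e) ⟧
    ; weight        = w ∘ edgeAt
    ; weight-nonneg = w≥0 ∘ edgeAt
    ; no-loops      = no-loops′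
    ; no-parallel   = no-parallel′
    }

  weight-⌊⌋ : ∀ x → weight graph ⌊ x ⌋ ≡ w x
  weight-⌊⌋ x = cong w (edgeAt-⌊⌋ x)

  step : ∀ {S} x → ⌊ x ⌋ ∈ S → Walk graph S ⟦ tail x ⟧ ⟦ head x ⟧
  step x x∈S = (⌊ x ⌋ , x∈S , inj₁ (cong (λ y → ⟦ tail y ⟧ , ⟦ head y ⟧) (edgeAt-⌊⌋ x))) ∷ []

  walkWeight-step : ∀ {S} x (x∈S : ⌊ x ⌋ ∈ S) → walkWeight (step x x∈S) ≡ w x
  walkWeight-step x _ = trans (ℚ.+-identityʳ _) (weight-⌊⌋ x)

vertex-count : ∀ a b → 2 ℕ.+ suc a ℕ.+ suc (suc a) ℕ.* suc b ℕ.≤ 5 ℕ.* (suc a ℕ.* suc b ℕ.* suc b)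
vertex-count a b = ℕ.≤-trans (ℕ.m≤m+n _ _) (ℕ.≤-reflexive (identity a b))
  where
  open import Data.Nat.Solver using (module +-*-Solver)
  open +-*-Solver
  -- The slack is the difference of the two sides, so the bound reduces to a semiring identity.
  identity : ∀ a b → 2 ℕ.+ suc a ℕ.+ suc (suc a) ℕ.* suc b
                       ℕ.+ (3 ℕ.* a ℕ.+ 8 ℕ.* b ℕ.+ 9 ℕ.* (a ℕ.* b) ℕ.+ 5 ℕ.* (b ℕ.* b) ℕ.+ 5 ℕ.* (a ℕ.* b ℕ.* b))
                     ≡ 5 ℕ.* (suc a ℕ.* suc b ℕ.* suc b)
  identity = solve 2 (λ a b → con 2 :+ (con 1 :+ a) :+ (con 2 :+ a) :* (con 1 :+ b)
                                :+ (con 3 :* a :+ con 8 :* b :+ con 9 :* (a :* b) :+ con 5 :* (b :* b) :+ con 5 :* (a :* b :* b))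
                              := con 5 :* ((con 1 :+ a) :* (con 1 :+ b) :* (con 1 :+ b))) refl

lightness-arith : ∀ {n a b} (W k : ℚ) → 0ℚ ≤ k → n ℕ.≤ 5 ℕ.* (a ℕ.* b ℕ.* b) → ℕ→ℚ a ≤ W →
                  ℤ.+ 1 / 10 * ℕ→ℚ n * (k + k) ≤ W * ℕ→ℚ b * ℕ→ℚ b * k
lightness-arith {n} {a} {b} W k 0≤k n≤5abb a≤W = begin
  ℤ.+ 1 / 10 * ℕ→ℚ n * (k + k)                  ≡⟨ halve (ℕ→ℚ n) k ⟩
  ℤ.+ 1 / 5 * ℕ→ℚ n * k                         ≤⟨ *k-mono (ℚ.*-monoˡ-≤-nonNeg (ℤ.+ 1 / 5) (ℕ→ℚ-mono-≤ n≤5abb)) ⟩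
  ℤ.+ 1 / 5 * ℕ→ℚ (5 ℕ.* (a ℕ.* b ℕ.* b)) * k  ≡⟨ cong (λ z → ℤ.+ 1 / 5 * z * k) (ℕ→ℚ-* 5 (a ℕ.* b ℕ.* b)) ⟩
  ℤ.+ 1 / 5 * (ℕ→ℚ 5 * y) * k                   ≡⟨ cancel-5 y k ⟩
  y * k                                          ≡⟨ cong (_* k) y≡abb ⟩
  ℕ→ℚ a * ℕ→ℚ b * ℕ→ℚ b * k                     ≤⟨ *k-mono (*b-mono (*b-mono a≤W)) ⟩
  W * ℕ→ℚ b * ℕ→ℚ b * k                         ∎
  where
  open ℚ.≤-Reasoning
  open import Data.Rational.Solver using (module +-*-Solver)
  open +-*-Solver
  y : ℚ
  y = ℕ→ℚ (a ℕ.* b ℕ.* b)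
  y≡abb : y ≡ ℕ→ℚ a * ℕ→ℚ b * ℕ→ℚ b
  y≡abb = trans (ℕ→ℚ-* (a ℕ.* b) b) (cong (_* ℕ→ℚ b) (ℕ→ℚ-* a b))
  halve : ∀ p q → ℤ.+ 1 / 10 * p * (q + q) ≡ ℤ.+ 1 / 5 * p * q
  halve = solve 2 (λ p q → con (ℤ.+ 1 / 10) :* p :* (q :+ q) := con (ℤ.+ 1 / 5) :* p :* q) refl
  cancel-5 : ∀ p q → ℤ.+ 1 / 5 * (ℕ→ℚ 5 * p) * q ≡ p * q
  cancel-5 = solve 2 (λ p q → con (ℤ.+ 1 / 5) :* (con (ℕ→ℚ 5) :* p) :* q := p :* q) refl
  *k-mono : ∀ {p q} → p ≤ q → p * k ≤ q * k
  *k-mono = ℚ.*-monoʳ-≤-nonNeg k {{nonNegative 0≤k}}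
  *b-mono : ∀ {p q} → p ≤ q → p * ℕ→ℚ b ≤ q * ℕ→ℚ b
  *b-mono = ℚ.*-monoʳ-≤-nonNeg (ℕ→ℚ b) {{nonNegative (ℕ→ℚ-mono-≤ {0} {b} z≤n)}}

module Construction (N f′ : ℕ) (k : ℚ) (1≤k : 1ℚ ≤ k) where

  L f : ℕ
  L = suc N
  f = suc f′

  data Vertex : Set where
    hub : Fin (2 ℕ.+ L) → Vertex
    mid : Fin (suc L) → Fin f → Vertex

  data Edge : Set where
    chord          : Fin L → Edge
    long           : Edge
    railIn railOut : Fin (suc L) → Fin f → Edge

  -- Gap g lies between hub (inject₁ g) and hub (suc g); chord i spans gap suc i,
  -- so gap zero is the one without a chord.
  tail head : Edge → Vertex
  tail (chord i)     = hub (inject₁ (suc i))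
  tail long          = hub zero
  tail (railIn g _)  = hub (inject₁ g)
  tail (railOut g r) = mid g r
  head (chord i)     = hub (suc (suc i))
  head long          = hub (fromℕ (suc L))
  head (railIn g r)  = mid g r
  head (railOut g _) = hub (suc g)

  0<k : 0ℚ < k
  0<k = ℚ.<-≤-trans (ℚ.positive⁻¹ 1ℚ) 1≤k

  0<k+k : 0ℚ < k + k
  0<k+k = ℚ.<-≤-trans 0<k (p≤p+q (ℚ.<⇒≤ 0<k))

  w : Edge → ℚ
  w (chord _)     = 1ℚ
  w long          = k + k
  w (railIn _ _)  = 0ℚ
  w (railOut _ _) = 0ℚ

  w≥0 : ∀ x → 0ℚ ≤ w x
  w≥0 (chord _)     = ℚ.nonNegative⁻¹ 1ℚ
  w≥0 long          = ℚ.<⇒≤ 0<k+k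
  w≥0 (railIn _ _)  = ℚ.≤-refl
  w≥0 (railOut _ _) = ℚ.≤-refl

  rank : Vertex → ℕ
  rank (hub h)   = toℕ h ℕ.+ toℕ h
  rank (mid g _) = suc (toℕ g ℕ.+ toℕ g)

  rank-< : ∀ x → rank (tail x) ℕ.< rank (head x)
  rank-< (chord i)     = ℕ.+-mono-< i<i+1 i<i+1
    where
    i<i+1 : suc (toℕ (inject₁ i)) ℕ.< suc (suc (toℕ i))
    i<i+1 = s≤s (s≤s (ℕ.≤-reflexive (Fin.toℕ-inject₁ i)))
  rank-< long          = s≤s z≤n
  rank-< (railIn g _)  = s≤s (ℕ.≤-reflexive (cong₂ ℕ._+_ (Fin.toℕ-inject₁ g) (Fin.toℕ-inject₁ g)))
  rank-< (railOut g _) = s≤s (ℕ.+-monoʳ-< (toℕ g) ℕ.≤-refl)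

  endpoints-injective : ∀ {x y} → tail x ≡ tail y → head x ≡ head y → x ≡ y
  endpoints-injective {chord _}     {chord _}     _  refl = refl
  endpoints-injective {long}        {long}        _  _    = refl
  endpoints-injective {railIn _ _}  {railIn _ _}  _  refl = refl
  endpoints-injective {railOut _ _} {railOut _ _} refl _  = refl
  endpoints-injective {chord _}     {long}        ()
  endpoints-injective {chord _}     {railIn _ _}  _  ()
  endpoints-injective {chord _}     {railOut _ _} ()
  endpoints-injective {long}        {chord _}     ()
  endpoints-injective {long}        {railIn _ _}  _  ()
  endpoints-injective {long}        {railOut _ _} ()
  endpoints-injective {railIn _ _}  {chord _}     _  ()
  endpoints-injective {railIn _ _}  {long}        _  ()
  endpoints-injective {railIn _ _}  {railOut _ _} ()
  endpoints-injective {railOut _ _} {chord _}     ()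
  endpoints-injective {railOut _ _} {long}        ()
  endpoints-injective {railOut _ _} {railIn _ _}  ()

  Rail : Set
  Rail = Fin (suc L) × Fin f

  n M : ℕ
  n = 2 ℕ.+ L ℕ.+ suc L ℕ.* f
  M = L ℕ.+ (1 ℕ.+ (suc L ℕ.* f ℕ.+ suc L ℕ.* f))

  vertex↔ : Vertex ↔ Fin n
  vertex↔ = ↔-trans (mk↔ₛ′ code decode (λ { (inj₁ _) → refl ; (inj₂ _) → refl })
                                         (λ { (hub _) → refl ; (mid _ _) → refl }))
                    (↔-sym (↔-trans +↔⊎ (↔-refl ⊎-↔ *↔×)))
    where
    code : Vertex → Fin (2 ℕ.+ L) ⊎ Rail
    code (hub h)   = inj₁ h
    code (mid g r) = inj₂ (g , r)
    decode : Fin (2 ℕ.+ L) ⊎ Rail → Vertex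
    decode (inj₁ h)       = hub h
    decode (inj₂ (g , r)) = mid g r

  edge↔ : Edge ↔ Fin M
  edge↔ = ↔-trans (mk↔ₛ′ code decode
                    (λ { (inj₁ _) → refl ; (inj₂ (inj₁ _)) → refl
                       ; (inj₂ (inj₂ (inj₁ _))) → refl ; (inj₂ (inj₂ (inj₂ _))) → refl })
                    (λ { (chord _) → refl ; long → refl ; (railIn _ _) → refl ; (railOut _ _) → refl }))
                  (↔-sym (↔-trans +↔⊎ (↔-refl ⊎-↔ ↔-trans +↔⊎ (1↔⊤ ⊎-↔
                                                  ↔-trans +↔⊎ (*↔× ⊎-↔ *↔×)))))
    where
    code : Edge → Fin L ⊎ (Unit ⊎ (Rail ⊎ Rail))
    code (chord i)     = inj₁ i
    code long          = inj₂ (inj₁ tt)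
    code (railIn g r)  = inj₂ (inj₂ (inj₁ (g , r)))
    code (railOut g r) = inj₂ (inj₂ (inj₂ (g , r)))
    decode : Fin L ⊎ (Unit ⊎ (Rail ⊎ Rail)) → Edge
    decode (inj₁ i)                    = chord i
    decode (inj₂ (inj₁ _))             = long
    decode (inj₂ (inj₂ (inj₁ (g , r)))) = railIn g r
    decode (inj₂ (inj₂ (inj₂ (g , r)))) = railOut g r

  open RankedGraph vertex↔ edge↔ tail head w w≥0 rank rank-< endpoints-injective public

  G : WGraph n
  G = graph

  level : Vertex → ℕ
  level (hub h)   = toℕ h
  level (mid g _) = toℕ g

  level-mono : ∀ x → level (tail x) ℕ.≤ level (head x)
  level-mono (chord i)     = s≤s (ℕ.m≤n⇒m≤1+n (ℕ.≤-reflexive (Fin.toℕ-inject₁ i)))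
  level-mono long          = z≤n
  level-mono (railIn g _)  = ℕ.≤-reflexive (Fin.toℕ-inject₁ g)
  level-mono (railOut g _) = ℕ.n≤1+n (toℕ g)

  data CrossesGap (g : Fin (suc L)) : Edge → Set where
    long    : CrossesGap g long
    chord   : ∀ {i} → suc i ≡ g → CrossesGap g (chord i)
    railOut : ∀ {g′} r → g′ ≡ g → CrossesGap g (railOut g′ r)

  crosses-gap : ∀ g x → level (tail x) ℕ.≤ toℕ g → toℕ g ℕ.< level (head x) → CrossesGap g x
  crosses-gap g (chord i) i<g g≤i =
    chord (Fin.toℕ-injective (ℕ.≤-antisym (subst (ℕ._≤ toℕ g) (cong suc (Fin.toℕ-inject₁ i)) i<g)
                                          (ℕ.≤-pred g≤i)))
  crosses-gap g long _ _ = long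
  crosses-gap g (railIn g′ _) g′≤g g<g′ =
    ⊥-elim (ℕ.<-irrefl (Fin.toℕ-inject₁ g′) (ℕ.≤-<-trans g′≤g g<g′))
  crosses-gap g (railOut g′ r) g′≤g g<g′ = railOut r (Fin.toℕ-injective (ℕ.≤-antisym g′≤g (ℕ.≤-pred g<g′)))

  LeftOf : Fin (suc L) → Fin n → Set
  LeftOf g u = level (vertexAt u) ℕ.≤ toℕ g

  left⁺ : ∀ {g v} → level v ℕ.≤ toℕ g → LeftOf g ⟦ v ⟧
  left⁺ {g} {v} = subst (ℕ._≤ toℕ g) (cong level (sym (vertexAt-⟦⟧ v)))

  left⁻ : ∀ {g v} → LeftOf g ⟦ v ⟧ → level v ℕ.≤ toℕ g
  left⁻ {g} {v} = subst (ℕ._≤ toℕ g) (cong level (vertexAt-⟦⟧ v))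

  crossing-gap : ∀ g {S u v} (p : Walk G S u v) → LeftOf g u → ¬ LeftOf g v →
                 ∃[ x ] (⌊ x ⌋ ∈ S × CrossesGap g x × w x ≤ walkWeight p)
  crossing-gap g {S} p u-left v-right with crossing-edge (λ u → level (vertexAt u) ℕ.≤? toℕ g) p u-left v-right
  ... | e , e∈S , (_ , _ , joins , x-left , y-right) , w≤ =
    edgeAt e , subst (_∈ S) (sym (⌊⌋-edgeAt e)) e∈S , orient joins x-left y-right , w≤
    where
    x : Edge
    x = edgeAt e
    orient : ∀ {u v} → Joins G e u v → LeftOf g u → ¬ LeftOf g v → CrossesGap g x
    orient (inj₁ refl) tail-left  head-right =
      crosses-gap g x (left⁻ {v = tail x} tail-left) (ℕ.≰⇒> (head-right ∘ left⁺ {v = head x}))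
    orient (inj₂ refl) head-left  tail-right =
      ⊥-elim (tail-right (left⁺ {v = tail x} (ℕ.≤-trans (level-mono x) (left⁻ {v = head x} head-left))))

  cut : Fin (suc L) → EdgeSet G
  cut g = image (λ r → ⌊ railOut g r ⌋)

  ∣cut∣≤f : ∀ g → ∣ cut g ∣ ℕ.≤ f
  ∣cut∣≤f g = ∣image∣≤ (λ r → ⌊ railOut g r ⌋)

  ∉cut : ∀ g x → (∀ r → railOut g r ≢ x) → ⌊ x ⌋ ∉ cut g
  ∉cut g _ ≢x x∈cut = let r , eq = ∈-image⁻ (λ r → ⌊ railOut g r ⌋) x∈cut in ≢x r (⌊⌋-injective eq)

  backbone : EdgeSet G
  backbone = ∁ (image (⌊_⌋ ∘ chord))

  ∈backbone : ∀ x → (∀ i → chord i ≢ x) → ⌊ x ⌋ ∈ backbone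
  ∈backbone _ ≢x = x∉p⇒x∈∁p λ x∈chords →
    let i , eq = ∈-image⁻ (⌊_⌋ ∘ chord) x∈chords in ≢x i (⌊⌋-injective eq)

  backbone-chordless : ∀ {e} → e ∈ backbone → ∀ i → edgeAt e ≢ chord i
  backbone-chordless {e} e∈backbone i eq =
    x∈∁p⇒x∉p e∈backbone (subst (_∈ _) (trans (cong ⌊_⌋ (sym eq)) (⌊⌋-edgeAt e)) (∈-image⁺ (⌊_⌋ ∘ chord) i))

  w-off-long : ∀ x → (∀ i → x ≢ chord i) → x ≢ long → w x ≡ 0ℚ
  w-off-long (chord i)     ≢chord _     = ⊥-elim (≢chord i refl)
  w-off-long long          _      ≢long = ⊥-elim (≢long refl)
  w-off-long (railIn _ _)  _      _     = refl
  w-off-long (railOut _ _) _      _     = refl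

  backbone-weight : totalWeight G backbone ≡ k + k
  backbone-weight = trans (totalWeight-single G (∈backbone long λ _ ()) rails-weightless) (weight-⌊⌋ long)
    where
    rails-weightless : ∀ e → e ∈ backbone → e ≢ ⌊ long ⌋ → weight G e ≡ 0ℚ
    rails-weightless e e∈backbone e≢long =
      w-off-long (edgeAt e) (backbone-chordless e∈backbone) (λ eq → e≢long (trans (sym (⌊⌋-edgeAt e)) (cong ⌊_⌋ eq)))

  RailOpen : EdgeSet G → Fin (suc L) → Fin f → Set
  RailOpen S g r = ⌊ railIn g r ⌋ ∈ S × ⌊ railOut g r ⌋ ∈ S

  across : ∀ {S g r} → RailOpen S g r → Walk G S ⟦ hub (inject₁ g) ⟧ ⟦ hub (suc g) ⟧
  across (in∈S , out∈S) = step (railIn _ _) in∈S ++ʷ step (railOut _ _) out∈S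

  detour : ∀ {S} c → ⌊ long ⌋ ∈ S → (∀ g → g ≢ c → RailOpen S g zero) →
           Walk G S ⟦ hub (inject₁ c) ⟧ ⟦ hub (suc c) ⟧
  detour {S} c long∈S others-open =
    reverseʷ (fromStart (inject₁ c) (ℕ.≤-reflexive (Fin.toℕ-inject₁ c)))
      ++ʷ step long long∈S
      ++ʷ reverseʷ (toEnd (suc c) ℕ.≤-refl)
    where
    fromStart : ∀ h → toℕ h ℕ.≤ toℕ c → Walk G S ⟦ hub zero ⟧ ⟦ hub h ⟧
    fromStart = <-weakInduction _ (λ _ → []) λ g walk g<c →
      walk (subst (ℕ._≤ toℕ c) (sym (Fin.toℕ-inject₁ g)) (ℕ.<⇒≤ g<c))
        ++ʷ across (others-open g λ { refl → ℕ.<-irrefl refl g<c })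
    toEnd : ∀ h → toℕ c ℕ.< toℕ h → Walk G S ⟦ hub h ⟧ ⟦ hub (fromℕ (suc L)) ⟧
    toEnd = >-weakInduction _ (λ _ → []) λ g walk c<g →
      across (others-open g λ { refl → ℕ.<-irrefl (sym (Fin.toℕ-inject₁ g)) c<g })
        ++ʷ walk (ℕ.m<n⇒m<1+n (subst (toℕ c ℕ.<_) (Fin.toℕ-inject₁ g) c<g))

  data RailOf (g : Fin (suc L)) (r : Fin f) : Edge → Set where
    in-rail  : RailOf g r (railIn g r)
    out-rail : RailOf g r (railOut g r)

  RailOf-unique : ∀ {g r r′ x} → RailOf g r x → RailOf g r′ x → r ≡ r′
  RailOf-unique in-rail  in-rail  = refl
  RailOf-unique out-rail out-rail = refl

  -- One faulted rail from each of the f disjoint pairs of gap c already gives f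
  -- distinct elements of F - ⌊ y ⌋, which leaves no room for y in F.
  faults-confined : ∀ {F : EdgeSet G} → ∣ F ∣ ℕ.≤ f → ∀ c → (∀ r → ∃[ x ] (RailOf c r x × ⌊ x ⌋ ∈ F)) →
                    ∀ y → (∀ r → ¬ RailOf c r y) → ⌊ y ⌋ ∉ F
  faults-confined {F} ∣F∣≤f c hit y off-gap y∈F = ℕ.<-irrefl refl (begin-strict
    f                  ≤⟨ injective⇒≤∣p∣ h h-injective h∈F-y ⟩
    ∣ F - ⌊ y ⌋ ∣      <⟨ x∈p⇒∣p-x∣<∣p∣ y∈F ⟩
    ∣ F ∣              ≤⟨ ∣F∣≤f ⟩
    f                  ∎)
    where
    open ℕ.≤-Reasoning
    h : Fin f → Fin M
    h r = ⌊ proj₁ (hit r) ⌋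
    h-injective : Injective _≡_ _≡_ h
    h-injective {r} {r′} eq =
      RailOf-unique (proj₁ (proj₂ (hit r))) (subst (RailOf c r′) (sym (⌊⌋-injective eq)) (proj₁ (proj₂ (hit r′))))
    h∈F-y : ∀ r → h r ∈ F - ⌊ y ⌋
    h∈F-y r = x∈p∧x≢y⇒x∈p-y (proj₂ (proj₂ (hit r)))
                (λ eq → off-gap r (subst (RailOf c r) (⌊⌋-injective eq) (proj₁ (proj₂ (hit r)))))

  chord-bypass : ∀ {F} → ∣ F ∣ ℕ.≤ f → ∀ i → Walk G (backbone ∖ F) ⟦ tail (chord i) ⟧ ⟦ head (chord i) ⟧
  chord-bypass {F} ∣F∣≤f i
    with Fin.any? (λ r → ¬? (⌊ railIn (suc i) r ⌋ ∈? F) ×-dec ¬? (⌊ railOut (suc i) r ⌋ ∈? F))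
  ... | yes (r , in∉F , out∉F) = across (∈-∖⁺ (∈backbone (railIn (suc i) r) λ _ ()) in∉F ,
                                         ∈-∖⁺ (∈backbone (railOut (suc i) r) λ _ ()) out∉F)
  ... | no  blocked = detour (suc i) (∈-∖⁺ (∈backbone long λ _ ()) (spared long λ _ ())) others-open
    where
    hit : ∀ r → ∃[ x ] (RailOf (suc i) r x × ⌊ x ⌋ ∈ F)
    hit r with ⌊ railIn (suc i) r ⌋ ∈? F
    ... | yes in∈F = railIn (suc i) r , in-rail , in∈F
    ... | no  in∉F = railOut (suc i) r , out-rail , decidable-stable (_ ∈? F) (λ out∉F → blocked (r , in∉F , out∉F))
    spared : ∀ y → (∀ r → ¬ RailOf (suc i) r y) → ⌊ y ⌋ ∉ F
    spared = faults-confined ∣F∣≤f (suc i) hit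
    others-open : ∀ g → g ≢ suc i → RailOpen (backbone ∖ F) g zero
    others-open g g≢c =
      ∈-∖⁺ (∈backbone (railIn g zero) λ _ ()) (spared (railIn g zero) λ { _ in-rail → g≢c refl }) ,
      ∈-∖⁺ (∈backbone (railOut g zero) λ _ ()) (spared (railOut g zero) λ { _ out-rail → g≢c refl })

  backbone-preserves : IsFTConnPreserver G f backbone
  backbone-preserves F ∣F∣≤f u v = Walk-mono (λ e∈ → ∈-∖⁺ ∈⊤ (proj₂ (∈-∖⁻ e∈))) , reroute bypass
    where
    bypass-edge : ∀ x → ⌊ x ⌋ ∉ F → Walk G (backbone ∖ F) ⟦ tail x ⟧ ⟦ head x ⟧
    bypass-edge (chord i)     _   = chord-bypass ∣F∣≤f i
    bypass-edge long          x∉F = step long (∈-∖⁺ (∈backbone long λ _ ()) x∉F)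
    bypass-edge (railIn g r)  x∉F = step (railIn g r) (∈-∖⁺ (∈backbone (railIn g r) λ _ ()) x∉F)
    bypass-edge (railOut g r) x∉F = step (railOut g r) (∈-∖⁺ (∈backbone (railOut g r) λ _ ()) x∉F)
    bypass : ∀ {e} → e ∈ ⊤ ∖ F → Walk G (backbone ∖ F) (proj₁ (ends G e)) (proj₂ (ends G e))
    bypass {e} e∈ = bypass-edge (edgeAt e) (subst (_∉ F) (sym (⌊⌋-edgeAt e)) (proj₂ (∈-∖⁻ e∈)))

  long∈preserver : ∀ {Q} → IsFTConnPreserver G f Q → ⌊ long ⌋ ∈ Q
  long∈preserver {Q} preserves =
    let x , x∈ , crosses , _ = crossing-gap zero Q-walk start-left end-right in only-long x∈ crosses
    where
    start-left : LeftOf zero ⟦ hub zero ⟧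
    start-left = left⁺ {v = hub zero} z≤n
    end-right : ¬ LeftOf zero ⟦ hub (fromℕ (suc L)) ⟧
    end-right = ℕ.n≮0 ∘ left⁻ {v = hub (fromℕ (suc L))}
    Q-walk : Walk G (Q ∖ cut zero) ⟦ hub zero ⟧ ⟦ hub (fromℕ (suc L)) ⟧
    Q-walk = proj₂ (preserves (cut zero) (∣cut∣≤f zero) _ _) (step long (∈-∖⁺ ∈⊤ (∉cut zero long λ _ ())))
    only-long : ∀ {x} → ⌊ x ⌋ ∈ Q ∖ cut zero → CrossesGap zero x → ⌊ long ⌋ ∈ Q
    only-long long∈ long             = proj₁ (∈-∖⁻ long∈)
    only-long _     (chord ())
    only-long x∈    (railOut r refl) = ⊥-elim (proj₂ (∈-∖⁻ x∈) (∈-image⁺ (λ r → ⌊ railOut zero r ⌋) r))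

  backbone-minimum : ∀ Q → IsFTConnPreserver G f Q → totalWeight G backbone ≤ totalWeight G Q
  backbone-minimum Q preserves =
    subst (_≤ totalWeight G Q) (trans (weight-⌊⌋ long) (sym backbone-weight))
          (weight≤totalWeight G (long∈preserver preserves))

  k<k+k : k < k + k
  k<k+k = subst (_< k + k) (ℚ.+-identityˡ k) (ℚ.+-monoˡ-< k 0<k)

  chord∈spanner : ∀ {H} → IsFTSpanner G f k H → ∀ i → ⌊ chord i ⌋ ∈ H
  chord∈spanner {H} spans i =
    let x , x∈ , crosses , w≤ = crossing-gap (suc i) P′ tail-left head-right in only-chord x∈ crosses w≤
    where
    F : EdgeSet G
    F = cut (suc i)
    chord-unfaulted : ⌊ chord i ⌋ ∈ ⊤ ∖ F
    chord-unfaulted = ∈-∖⁺ ∈⊤ (∉cut (suc i) (chord i) λ _ ())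
    P : Walk G (⊤ ∖ F) ⟦ tail (chord i) ⟧ ⟦ head (chord i) ⟧
    P = step (chord i) chord-unfaulted
    P′ : Walk G (H ∖ F) ⟦ tail (chord i) ⟧ ⟦ head (chord i) ⟧
    P′ = proj₁ (spans F (∣cut∣≤f (suc i)) _ _ P)
    P′≤k : walkWeight P′ ≤ k
    P′≤k = ℚ.≤-trans (proj₂ (spans F (∣cut∣≤f (suc i)) _ _ P))
                     (ℚ.≤-reflexive (trans (cong (k *_) (walkWeight-step (chord i) chord-unfaulted)) (ℚ.*-identityʳ k)))
    tail-left : LeftOf (suc i) ⟦ tail (chord i) ⟧
    tail-left = left⁺ {v = tail (chord i)} (s≤s (ℕ.≤-reflexive (Fin.toℕ-inject₁ i)))
    head-right : ¬ LeftOf (suc i) ⟦ head (chord i) ⟧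
    head-right = ℕ.<-irrefl refl ∘ left⁻ {v = head (chord i)}
    only-chord : ∀ {x} → ⌊ x ⌋ ∈ H ∖ F → CrossesGap (suc i) x → w x ≤ walkWeight P′ → ⌊ chord i ⌋ ∈ H
    only-chord _  long             w≤ = ⊥-elim (ℚ.<-irrefl refl (ℚ.<-≤-trans k<k+k (ℚ.≤-trans w≤ P′≤k)))
    only-chord x∈ (chord refl)     _  = proj₁ (∈-∖⁻ x∈)
    only-chord x∈ (railOut r refl) _  = ⊥-elim (proj₂ (∈-∖⁻ x∈) (∈-image⁺ (λ r → ⌊ railOut (suc i) r ⌋) r))

  chords-weight : ∀ {H} → (∀ i → ⌊ chord i ⌋ ∈ H) → ℕ→ℚ L ≤ totalWeight G H
  chords-weight {H} chords∈H =
    subst (_≤ totalWeight G H) (sumFin-ones L chord-summand) (sumFin-↑ˡ L _ (summand-nonNeg G H))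
    where
    chord-summand : ∀ i → summand G H (i ↑ˡ _) ≡ 1ℚ
    chord-summand i = trans (summand-∈ G (chords∈H i)) (weight-⌊⌋ (chord i))

  N≤n : N ℕ.≤ n
  N≤n = ℕ.≤-trans (ℕ.m≤n+m N 3) (ℕ.m≤m+n (3 ℕ.+ N) (suc L ℕ.* f))

  spanner-lightness : ∀ H → IsFTSpanner G f k H →
                      ℤ.+ 1 / 10 * ℕ→ℚ n * totalWeight G backbone ≤ totalWeight G H * ℕ→ℚ f * ℕ→ℚ f * k
  spanner-lightness H spans =
    subst (λ q → ℤ.+ 1 / 10 * ℕ→ℚ n * q ≤ totalWeight G H * ℕ→ℚ f * ℕ→ℚ f * k) (sym backbone-weight)
      (lightness-arith {a = L} {b = f} (totalWeight G H) k (ℚ.<⇒≤ 0<k)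
                       (vertex-count N f′) (chords-weight (chord∈spanner spans)))

theorem1p9 :
    Σ ℚ λ c → 0ℚ < c ×
      (∀ (f : ℕ) → f ≥ 1 → ∀ (k : ℚ) → 1ℚ ≤ k → ∀ (N : ℕ) →
        ∃[ n ] (n ≥ N × Σ (WGraph n) λ G →
          -- Q is a minimum-weight f-EFT connectivity preserver, w(Q) > 0
          ∃[ Q ] (IsFTConnPreserver G f Q ×
                  (∀ Q′ → IsFTConnPreserver G f Q′ → totalWeight G Q ≤ totalWeight G Q′) ×
                  0ℚ < totalWeight G Q ×
                  -- every f-EFT k-spanner H has w(H)/w(Q) ≥ c · n / (f² k)
                  (∀ H → IsFTSpanner G f k H →
                    c * ℕ→ℚ n * totalWeight G Q ≤ totalWeight G H * ℕ→ℚ f * ℕ→ℚ f * k))))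
theorem1p9 = ℤ.+ 1 / 10 , ℚ.positive⁻¹ (ℤ.+ 1 / 10) , λ where
  zero     ()
  (suc f′) _ k 1≤k N →
    let open Construction N f′ k 1≤k in
    n , N≤n , G , backbone , backbone-preserves , backbone-minimum ,
    subst (0ℚ <_) (sym backbone-weight) 0<k+k , spanner-lightness
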